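{- Let $m_1,\ldots,m_n$ be nonnegative integers and $A=(a_{ij})_{1\leqslant i,j\leqslant n}$ a complex matrix. Let $P(x_1,\ldots,x_n)\in\mathbb{C}[x_1,\ldots,x_n]$ be homogeneous and suppose there is $\nu\in\{1,-1\}$ such that for all $1\leqslant i<j\leqslant n$, swapping the variables $x_i$ and $x_j$ in $P$ yields $\nu P(x_1,\ldots,x_n)$. Set $$f(x_1,\ldots,x_n)=\det\big(a_{ij}x_j^{m_i}\big)_{1\leqslant i,j\leqslant n}\,P(x_1,\ldots,x_n).$$ Then, as polynomials in $x$, $$f^*(x,\ldots,x)=P^*(x-m_1,\ldots,x-m_n)\prod_{i=1}^n (x)_{m_i}\times\begin{cases}\det(A)&\text{if }\nu=1,\\ \operatorname{per}(A)&\text{if }\nu=-1.\end{cases}$$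
   Context: Falling factorials: $(x)_0=1$ and $(x)_r=x(x-1)\cdots(x-r+1)$ for $r\geqslant 1$. For a polynomial $Q=\sum c_{j_1,\ldots,j_n}x_1^{j_1}\cdots x_n^{j_n}$, define $Q^*(x_1,\ldots,x_n)=\sum c_{j_1,\ldots,j_n}(x_1)_{j_1}\cdots(x_n)_{j_n}$. The permanent of $A=(a_{ij})$ is $\operatorname{per}(A)=\sum_{\sigma\in S_n}\prod_{i=1}^n a_{i,\sigma(i)}$. -}

module Defs where

open import Level using (Level)
open import Algebra.Bundles using (CommutativeRing)
open import Data.Bool using (Bool; true; false; if_then_else_; _∧_)
open import Data.Nat as ℕ using (ℕ; zero; suc; _≡ᵇ_; _<ᵇ_)
open import Data.Fin as Fin using (Fin; toℕ)
open import Data.Fin.Permutation.Components using (transpose)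
open import Data.List as List using (List; []; _∷_; _++_; foldr; concatMap; allFin; filter; length)
open import Data.Vec as Vec using (Vec; lookup; tabulate; zipWith; replicate)
open import Data.Product using (_×_; _,_)

data Sign : Set where
  plus minus : Sign

eqV : ∀ {n} → Vec ℕ n → Vec ℕ n → Bool
eqV Vec.[] Vec.[] = true
eqV (a Vec.∷ as) (b Vec.∷ bs) = (a ≡ᵇ b) ∧ eqV as bs

eqF : ∀ {n} → Fin n → Fin n → Bool
eqF i j = toℕ i ≡ᵇ toℕ j

ltF : ∀ {n} → Fin n → Fin n → Bool
ltF i j = toℕ i <ᵇ toℕ j

funs : (n k : ℕ) → List (Fin k → Fin n)
funs n zero = (λ ()) ∷ []
funs n (suc k) =
  concatMap (λ f → List.map (λ a → λ { Fin.zero → a ; (Fin.suc i) → f i }) (allFin n)) (funs n k)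

pairs : (n : ℕ) → List (Fin n × Fin n)
pairs n = filter (λ { (i , j) → Data.Bool.T? (ltF i j) })
                 (concatMap (λ i → List.map (λ j → (i , j)) (allFin n)) (allFin n))
  where import Data.Bool

isInjective : ∀ {n} → (Fin n → Fin n) → Bool
isInjective {n} σ = foldr (λ { (i , j) b → Data.Bool.not (eqF (σ i) (σ j)) ∧ b }) true (pairs n)
  where import Data.Bool

perms : (n : ℕ) → List (Fin n → Fin n)
perms n = filter (λ σ → Data.Bool.T? (isInjective σ)) (funs n n)
  where import Data.Bool

inversions : ∀ {n} → (Fin n → Fin n) → List (Fin n × Fin n)
inversions {n} σ = filter (λ { (i , j) → Data.Bool.T? (ltF (σ j) (σ i)) }) (pairs n)
  where import Data.Bool

module Poly {c ℓ : Level} (R : CommutativeRing c ℓ) where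
  open CommutativeRing R public

  natR : ℕ → Carrier
  natR zero = 0#
  natR (suc k) = 1# + natR k

  sumR : List Carrier → Carrier
  sumR = foldr _+_ 0#

  prodR : ∀ k → (Fin k → Carrier) → Carrier
  prodR zero f = 1#
  prodR (suc k) f = f Fin.zero * prodR k (λ i → f (Fin.suc i))

  sgnR : ∀ {n} → (Fin n → Fin n) → Carrier
  sgnR σ = foldr (λ _ s → - s) 1# (inversions σ)

  det : ∀ {n} → (Fin n → Fin n → Carrier) → Carrier
  det {n} A = sumR (List.map (λ σ → sgnR σ * prodR n (λ i → A i (σ i))) (perms n))

  per : ∀ {n} → (Fin n → Fin n → Carrier) → Carrier
  per {n} A = sumR (List.map (λ σ → prodR n (λ i → A i (σ i))) (perms n))

  signVal : Sign → Carrier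
  signVal plus = 1#
  signVal minus = - 1#

  -- Polynomials in n variables: finite formal sums of terms c · x^e
  Pol : ℕ → Set c
  Pol n = List (Carrier × Vec ℕ n)

  coeff : ∀ {n} → Pol n → Vec ℕ n → Carrier
  coeff p e = foldr (λ { (c , e') acc → if eqV e' e then c + acc else acc }) 0# p

  _≈P_ : ∀ {n} → Pol n → Pol n → Set ℓ
  p ≈P q = ∀ e → coeff p e ≈ coeff q e

  infix 4 _≈P_
  infixl 7 _*P_
  infixl 6 _+P_ _-P_

  constP : ∀ {n} → Carrier → Pol n
  constP {n} r = (r , replicate n 0) ∷ []

  varP : ∀ {n} → Fin n → Pol n
  varP k = (1# , tabulate (λ i → if eqF i k then 1 else 0)) ∷ []

  _+P_ : ∀ {n} → Pol n → Pol n → Pol n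
  _+P_ = _++_

  scaleP : ∀ {n} → Carrier → Pol n → Pol n
  scaleP r = List.map (λ { (c , e) → (r * c , e) })

  _-P_ : ∀ {n} → Pol n → Pol n → Pol n
  p -P q = p ++ scaleP (- 1#) q

  _*P_ : ∀ {n} → Pol n → Pol n → Pol n
  p *P q = concatMap (λ { (c , e) → List.map (λ { (d , f) → (c * d , zipWith ℕ._+_ e f) }) q }) p

  sumP : ∀ {n} → List (Pol n) → Pol n
  sumP = foldr _+P_ []

  prodP : ∀ {n} k → (Fin k → Pol n) → Pol n
  prodP zero f = constP 1#
  prodP (suc k) f = f Fin.zero *P prodP k (λ i → f (Fin.suc i))

  powP : ∀ {n} → Pol n → ℕ → Pol n
  powP p zero = constP 1#
  powP p (suc r) = powP p r *P p

  ffP : ∀ {n} → Pol n → ℕ → Pol n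
  ffP y zero = constP 1#
  ffP y (suc r) = ffP y r *P (y -P constP (natR r))

  -- Q* : replace each x^j by the falling factorial (x)_j
  star : ∀ {n} → Pol n → Pol n
  star {n} Q = sumP (List.map (λ { (c , e) → scaleP c (prodP n (λ k → ffP (varP k) (lookup e k))) }) Q)

  subst : ∀ {n m} → Pol n → (Fin n → Pol m) → Pol m
  subst {n} Q g = sumP (List.map (λ { (c , e) → scaleP c (prodP n (λ k → powP (g k) (lookup e k))) }) Q)

  swapVars : ∀ {n} → Fin n → Fin n → Pol n → Pol n
  swapVars i j = List.map (λ { (c , e) → (c , tabulate (λ k → lookup e (transpose i j k))) })

  Homogeneous : ∀ {n} → Pol n → Set ℓ
  Homogeneous {n} P = Data.Product.Σ ℕ (λ d → ∀ e → ¬ (Vec.sum e ≡ d) → coeff P e ≈ 0#)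
    where open import Relation.Nullary using (¬_)
          open import Relation.Binary.PropositionalEquality using (_≡_)
          import Data.Product

  detP : ∀ {n} → (Fin n → Fin n → Pol n) → Pol n
  detP {n} M = sumP (List.map (λ σ → scaleP (sgnR σ) (prodP n (λ i → M i (σ i)))) (perms n))

  matP : ∀ {n} → (Fin n → ℕ) → (Fin n → Fin n → Carrier) → Fin n → Fin n → Pol n
  matP m A i j = (A i j , tabulate (λ k → if eqF k j then m i else 0)) ∷ []

  X : Pol 1
  X = varP Fin.zero

  detOrPer : ∀ {n} → Sign → (Fin n → Fin n → Carrier) → Carrier
  detOrPer plus A = det A
  detOrPer minus A = per A

{-# OPTIONS --safe #-}

-- Polynomials are lists of terms c · x^e, so a polynomial p acts on functions h from
-- exponent vectors to R by ev p h = Σ c · h e.  Testing against indicator functions shows that two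
-- polynomials have the same coefficients exactly when they act alike, and under this action
-- products, substitutions and Q ↦ Q* become explicit formulas.
--
-- Expanding the determinant, f = Σ_σ sgn σ · Π_i a_{i,σ i} · x^(m ∘ σ⁻¹) · P.  Since
-- (x)_(a+b) = (x)_a · (x − a)_b, the diagonal (x^y · P)*(x, …, x) of a summand is
-- Π_k (x)_(y k) · P*(x − y 1, …, x − y n).  Swapping two coordinates of y multiplies it by ν, by the
-- symmetry of P, and m ∘ σ⁻¹ is sorted back to m by one adjacent transposition per inversion of σ;
-- so the σ-summand is sgn σ · ν^inv(σ) · Π_i a_{i,σ i} times the one for σ = id.  Finally
-- sgn σ · ν^inv(σ) is sgn σ when ν = 1 and 1 when ν = −1.
module Submission where

open import Defs
open import Level using (Level; _⊔_)
open import Algebra.Bundles using (CommutativeRing; CommutativeMonoid)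
import Algebra.Properties.AbelianGroup as AbelianGroupProperties
import Algebra.Properties.CommutativeMonoid.Sum as MonoidSum
import Algebra.Properties.CommutativeSemigroup as CommSemigroupProperties
import Algebra.Properties.Ring as RingProperties
import Algebra.Properties.Semiring.Exp as Exp
open import Data.Bool using (Bool; true; false; if_then_else_; T; _∧_; not)
open import Data.Bool.Properties using (T?; T-∧)
open import Data.Empty using (⊥-elim)
open import Data.Fin as Fin using (Fin; zero; suc; toℕ; inject₁; fromℕ; _<_; _≟_)
open import Data.Fin.Induction using (<-weakInduction; >-weakInduction)
import Data.Fin.Permutation as Perm
open import Data.Fin.Permutation.Components using (transpose)
import Data.Fin.Properties as Finₚ
open import Data.List as List using (List; []; _∷_; _++_; map; filter; concatMap; allFin; length)
open import Data.List.Membership.Propositional using (_∈_)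
open import Data.List.Membership.Propositional.Properties using (∈-filter⁺; ∈-concatMap⁺; ∈-map⁺; ∈-allFin)
import Data.List.Properties as Listₚ
open import Data.List.Relation.Unary.All as All using (All; []; _∷_)
open import Data.List.Relation.Unary.All.Properties using (all-filter)
import Data.List.Relation.Unary.Any as Any
open import Data.Nat as ℕ using (ℕ; zero; suc)
open import Data.Nat.ListAction using (sum)
open import Data.Nat.ListAction.Properties using (sum-++)
import Data.Nat.Properties as ℕₚ
open import Data.Product using (_×_; _,_; proj₁; proj₂; ∃₂)
open import Data.Vec as Vec using (Vec; []; _∷_; lookup; tabulate; zipWith; replicate)
import Data.Vec.Properties as Vecₚ
open import Data.Vec.Relation.Binary.Pointwise.Inductive using (Pointwise-≡⇒≡; zipWith-comm; zipWith-assoc; zipWith-identityˡ)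
open import Function using (_∘_; Injective; Equivalence)
open import Relation.Binary using (tri<; tri≈; tri>)
import Relation.Binary.PropositionalEquality as ≡
open ≡ using (_≡_; _≢_)
open import Relation.Nullary using (¬_; Dec; yes; no; _×-dec_; contradiction)
open import Relation.Nullary.Reflects using (Reflects; ofʸ; ofⁿ; fromEquivalence)
open import Algebra.Properties.CommutativeMonoid.Sum ℕₚ.+-0-commutativeMonoid
  using (sum-cong-≗; sum-permute; ∑-distrib-+; sum-replicate-zero) renaming (sum to ∑)

module Permutations where

  open ≡
  open import Data.Nat using (_+_; _≤_; z≤n; s≤s)
  open Finₚ using (toℕ-injective; toℕ-inject₁; toℕ-fromℕ; toℕ<n)

  private variable
    n : ℕ

  reflects-true : ∀ {a} {A : Set a} {b} → Reflects A b → A → b ≡ true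
  reflects-true (ofʸ _) _ = refl
  reflects-true (ofⁿ ¬a) a = contradiction a ¬a

  reflects-false : ∀ {a} {A : Set a} {b} → Reflects A b → ¬ A → b ≡ false
  reflects-false (ofʸ a) ¬a = contradiction a ¬a
  reflects-false (ofⁿ _) _ = refl

  reflects-cong : ∀ {a b} {A : Set a} {B : Set b} {x y} → Reflects A x → Reflects B y →
                  (A → B) → (B → A) → x ≡ y
  reflects-cong (ofʸ _) (ofʸ _) _ _ = refl
  reflects-cong (ofʸ a) (ofⁿ ¬b) f _ = contradiction (f a) ¬b
  reflects-cong (ofⁿ ¬a) (ofʸ b) _ g = contradiction (g b) ¬a
  reflects-cong (ofⁿ _) (ofⁿ _) _ _ = refl

  ≡ᵇ-reflects : (a b : ℕ) → Reflects (a ≡ b) (a ℕ.≡ᵇ b)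
  ≡ᵇ-reflects a b = fromEquivalence (ℕₚ.≡ᵇ⇒≡ a b) (ℕₚ.≡⇒≡ᵇ a b)

  eqF-reflects : (i j : Fin n) → Reflects (i ≡ j) (eqF i j)
  eqF-reflects i j =
    fromEquivalence (toℕ-injective ∘ ℕₚ.≡ᵇ⇒≡ _ _) (ℕₚ.≡⇒≡ᵇ _ _ ∘ cong toℕ)

  ltF-reflects : (i j : Fin n) → Reflects (i < j) (ltF i j)
  ltF-reflects i j = ℕₚ.<ᵇ-reflects-< (toℕ i) (toℕ j)

  eqV-reflects : (e f : Vec ℕ n) → Reflects (e ≡ f) (eqV e f)
  eqV-reflects [] [] = ofʸ refl
  eqV-reflects (a ∷ e) (b ∷ f) with a ℕ.≡ᵇ b | ≡ᵇ-reflects a b | eqV e f | eqV-reflects e f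
  ... | true | ofʸ refl | true | ofʸ refl = ofʸ refl
  ... | true | ofʸ refl | false | ofⁿ e≢f = ofⁿ (e≢f ∘ Vecₚ.∷-injectiveʳ)
  ... | false | ofⁿ a≢b | _ | _ = ofⁿ (a≢b ∘ Vecₚ.∷-injectiveˡ)

  eqF-refl : (i : Fin n) → eqF i i ≡ true
  eqF-refl i = reflects-true (eqF-reflects i i) refl

  ltF≡true : {i j : Fin n} → i < j → ltF i j ≡ true
  ltF≡true = reflects-true (ltF-reflects _ _)

  ltF≡false : {i j : Fin n} → j < i → ltF i j ≡ false
  ltF≡false j<i = reflects-false (ltF-reflects _ _) (ℕₚ.<-asym j<i)

  transpose-matchˡ : (i j : Fin n) → transpose i j i ≡ j
  transpose-matchˡ i j with i ≟ i
  ... | yes _ = refl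
  ... | no i≢i = contradiction refl i≢i

  transpose-matchʳ : (i j : Fin n) → transpose i j j ≡ i
  transpose-matchʳ i j with j ≟ i
  ... | yes j≡i = j≡i
  ... | no _ with j ≟ j
  ...   | yes _ = refl
  ...   | no j≢j = contradiction refl j≢j

  transpose-other : {i j k : Fin n} → k ≢ i → k ≢ j → transpose i j k ≡ k
  transpose-other {i = i} {j} {k} k≢i k≢j with k ≟ i
  ... | yes k≡i = contradiction k≡i k≢i
  ... | no _ with k ≟ j
  ...   | yes k≡j = contradiction k≡j k≢j
  ...   | no _ = refl

  transpose-involutive : (i j k : Fin n) → transpose i j (transpose i j k) ≡ k
  transpose-involutive i j k = by-cases (k ≟ i) (k ≟ j)
    where
    by-cases : Dec (k ≡ i) → Dec (k ≡ j) → transpose i j (transpose i j k) ≡ k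
    by-cases (yes refl) _ = trans (cong (transpose k j) (transpose-matchˡ k j)) (transpose-matchʳ k j)
    by-cases (no _) (yes refl) = trans (cong (transpose i k) (transpose-matchʳ i k)) (transpose-matchˡ i k)
    by-cases (no k≢i) (no k≢j) = trans (cong (transpose i j) (transpose-other k≢i k≢j)) (transpose-other k≢i k≢j)

  transpose-preimage : {i j k l : Fin n} → transpose i j k ≡ l → k ≡ transpose i j l
  transpose-preimage {i = i} {j} {k} τk≡l = trans (sym (transpose-involutive i j k)) (cong (transpose i j) τk≡l)

  ∑-transpose : (f : Fin n → ℕ) (i j : Fin n) → ∑ f ≡ ∑ (f ∘ transpose i j)
  ∑-transpose f i j = sum-permute f (Perm.transpose i j)

  Adjacent : Fin n → Fin n → Set
  Adjacent a b = toℕ b ≡ suc (toℕ a)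

  module _ {a b : Fin n} (adj : Adjacent a b) where

    private
      τ : Fin n → Fin n
      τ = transpose a b

    adjacent⇒< : a < b
    adjacent⇒< = ℕₚ.≤-reflexive (sym adj)

    adjacent⇒≢ : a ≢ b
    adjacent⇒≢ a≡b = ℕₚ.<-irrefl (cong toℕ a≡b) adjacent⇒<

    <-skipˡ : ∀ {k} → a < k → k ≢ b → b < k
    <-skipˡ a<k k≢b = ℕₚ.≤∧≢⇒< (subst (ℕ._≤ toℕ _) (sym adj) a<k) (k≢b ∘ sym ∘ toℕ-injective)

    <-skipʳ : ∀ {k} → k < b → k ≢ a → k < a
    <-skipʳ k<b k≢a = ℕₚ.≤∧≢⇒< (ℕₚ.≤-pred (subst (suc (toℕ _) ℕ.≤_) adj k<b)) (k≢a ∘ toℕ-injective)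

    transpose-adjacent-mono : ∀ {i j} → ¬ (i ≡ a × j ≡ b) → i < j → τ i < τ j
    transpose-adjacent-mono {i} {j} ¬ab i<j = by-cases (i ≟ a) (i ≟ b) (j ≟ a) (j ≟ b)
      where
      irrefl : i ≢ j
      irrefl i≡j = ℕₚ.<-irrefl (cong toℕ i≡j) i<j
      by-cases : Dec (i ≡ a) → Dec (i ≡ b) → Dec (j ≡ a) → Dec (j ≡ b) → τ i < τ j
      by-cases (yes refl) _ _ (yes refl) = contradiction (refl , refl) ¬ab
      by-cases (yes refl) _ (yes refl) _ = contradiction refl irrefl
      by-cases (yes refl) _ (no j≢a) (no j≢b) =
        subst₂ _<_ (sym (transpose-matchˡ a b)) (sym (transpose-other j≢a j≢b)) (<-skipˡ i<j j≢b)
      by-cases (no _) (yes refl) _ (yes refl) = contradiction refl irrefl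
      by-cases (no _) (yes refl) (yes refl) _ = contradiction (ℕₚ.<-trans adjacent⇒< i<j) (ℕₚ.<-irrefl refl)
      by-cases (no _) (yes refl) (no j≢a) (no j≢b) =
        subst₂ _<_ (sym (transpose-matchʳ a b)) (sym (transpose-other j≢a j≢b)) (ℕₚ.<-trans adjacent⇒< i<j)
      by-cases (no i≢a) (no i≢b) (yes refl) _ =
        subst₂ _<_ (sym (transpose-other i≢a i≢b)) (sym (transpose-matchˡ a b)) (ℕₚ.<-trans i<j adjacent⇒<)
      by-cases (no i≢a) (no i≢b) (no _) (yes refl) =
        subst₂ _<_ (sym (transpose-other i≢a i≢b)) (sym (transpose-matchʳ a b)) (<-skipʳ i<j i≢a)
      by-cases (no i≢a) (no i≢b) (no j≢a) (no j≢b) =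
        subst₂ _<_ (sym (transpose-other i≢a i≢b)) (sym (transpose-other j≢a j≢b)) i<j

    ltF-transpose-adjacent : ∀ {i j} → ¬ (i ≡ a × j ≡ b) → ¬ (i ≡ b × j ≡ a) → ltF (τ i) (τ j) ≡ ltF i j
    ltF-transpose-adjacent {i} {j} ¬ab ¬ba =
      reflects-cong (ltF-reflects (τ i) (τ j)) (ltF-reflects i j) backward (transpose-adjacent-mono ¬ab)
      where
      backward : τ i < τ j → i < j
      backward τi<τj = subst₂ _<_ (transpose-involutive a b i) (transpose-involutive a b j)
        (transpose-adjacent-mono (λ { (τi≡a , τj≡b) → ¬ba
            ( trans (transpose-preimage τi≡a) (transpose-matchˡ a b)
            , trans (transpose-preimage τj≡b) (transpose-matchʳ a b)) })
          τi<τj)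

  fromBool : Bool → ℕ
  fromBool b = if b then 1 else 0

  inversion : (Fin n → Fin n) → Fin n → Fin n → ℕ
  inversion σ i j = if ltF i j then fromBool (ltF (σ j) (σ i)) else 0

  -- A double sum rather than the length of `inversions σ`, so that reindexing along a
  -- transposition is sum-permute.
  inversionCount : (Fin n → Fin n) → ℕ
  inversionCount σ = ∑ λ i → ∑ λ j → inversion σ i j

  module _ {a} {A : Set a} where

    length-filter : (p : A → Bool) (xs : List A) → length (filter (T? ∘ p) xs) ≡ sum (map (fromBool ∘ p) xs)
    length-filter p [] = refl
    length-filter p (x ∷ xs) with p x
    ... | true = cong suc (length-filter p xs)
    ... | false = length-filter p xs

    sum-map-filter : (q : A → Bool) (f : A → ℕ) (xs : List A) →
                     sum (map f (filter (T? ∘ q) xs)) ≡ sum (map (λ x → if q x then f x else 0) xs)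
    sum-map-filter q f [] = refl
    sum-map-filter q f (x ∷ xs) with q x
    ... | true = cong (f x +_) (sum-map-filter q f xs)
    ... | false = sum-map-filter q f xs

    sum-map-concatMap : ∀ {b} {B : Set b} (f : B → ℕ) (g : A → List B) (xs : List A) →
                        sum (map f (concatMap g xs)) ≡ sum (map (sum ∘ map f ∘ g) xs)
    sum-map-concatMap f g [] = refl
    sum-map-concatMap f g (x ∷ xs) = begin
      sum (map f (g x List.++ concatMap g xs))         ≡⟨ cong sum (Listₚ.map-++ f (g x) _) ⟩
      sum (map f (g x) List.++ map f (concatMap g xs)) ≡⟨ sum-++ (map f (g x)) _ ⟩
      sum (map f (g x)) + sum (map f (concatMap g xs)) ≡⟨ cong (sum (map f (g x)) +_) (sum-map-concatMap f g xs) ⟩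
      sum (map f (g x)) + sum (map (sum ∘ map f ∘ g) xs) ∎
      where open ≡-Reasoning

    sum-map-tabulate : (f : A → ℕ) (g : Fin n → A) → sum (map f (List.tabulate g)) ≡ ∑ (f ∘ g)
    sum-map-tabulate {zero} f g = refl
    sum-map-tabulate {suc n} f g = cong (f (g zero) +_) (sum-map-tabulate f (g ∘ suc))

  length-inversions : (σ : Fin n → Fin n) → length (inversions σ) ≡ inversionCount σ
  length-inversions {n} σ = begin
    length (inversions σ)
      ≡⟨ length-filter descent (pairs n) ⟩
    sum (map (fromBool ∘ descent) (pairs n))
      ≡⟨ sum-map-filter ascent (fromBool ∘ descent) allPairs ⟩
    sum (map f allPairs)
      ≡⟨ sum-map-concatMap f row (allFin n) ⟩
    sum (map (sum ∘ map f ∘ row) (allFin n))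
      ≡⟨ sum-map-tabulate (sum ∘ map f ∘ row) Function.id ⟩
    ∑ (λ i → sum (map f (row i)))
      ≡⟨ sum-cong-≗ (λ i → cong sum (sym (Listₚ.map-∘ {g = f} {f = i ,_} (allFin n)))) ⟩
    ∑ (λ i → sum (map (λ j → f (i , j)) (allFin n)))
      ≡⟨ sum-cong-≗ (λ i → sum-map-tabulate (λ j → f (i , j)) Function.id) ⟩
    inversionCount σ ∎
    where
    open ≡-Reasoning
    ascent descent : Fin n × Fin n → Bool
    ascent (i , j) = ltF i j
    descent (i , j) = ltF (σ j) (σ i)
    f : Fin n × Fin n → ℕ
    f (i , j) = inversion σ i j
    row : Fin n → List (Fin n × Fin n)
    row i = map (i ,_) (allFin n)
    allPairs : List (Fin n × Fin n)
    allPairs = concatMap row (allFin n)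

  ∑-δ : (a : Fin n) (f : Fin n → ℕ) → ∑ (λ i → if eqF a i then f i else 0) ≡ f a
  ∑-δ {suc n} zero f = trans (cong (f zero +_) (sum-replicate-zero n)) (ℕₚ.+-identityʳ (f zero))
  ∑-δ {suc n} (suc a) f = ∑-δ a (f ∘ suc)

  ∑-if : (c : Bool) (f : Fin n → ℕ) → ∑ (λ i → if c then f i else 0) ≡ (if c then ∑ f else 0)
  ∑-if {n} true f = refl
  ∑-if {n} false f = sum-replicate-zero n

  module _ (σ : Fin n → Fin n) {a b : Fin n} (adj : Adjacent a b) (σb<σa : σ b < σ a) where

    private
      τ : Fin n → Fin n
      τ = transpose a b

      δab : Fin n → Fin n → ℕ
      δab i j = if eqF a i then fromBool (eqF b j) else 0

    -- Reindexing along τ changes the inversion status of the pair (a , b) only.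
    inversion-split : ∀ i j → inversion σ i j ≡ δab i j + inversion (σ ∘ τ) (τ i) (τ j)
    inversion-split i j rewrite transpose-involutive a b i | transpose-involutive a b j =
      by-cases ((i ≟ a) ×-dec (j ≟ b)) ((i ≟ b) ×-dec (j ≟ a))
      where
      by-cases : Dec (i ≡ a × j ≡ b) → Dec (i ≡ b × j ≡ a) →
                 inversion σ i j ≡ δab i j + (if ltF (τ i) (τ j) then fromBool (ltF (σ j) (σ i)) else 0)
      by-cases (yes (refl , refl)) _
        rewrite transpose-matchˡ a b | transpose-matchʳ a b | ltF≡true (adjacent⇒< adj) | ltF≡true σb<σa
              | ltF≡false (adjacent⇒< adj) | eqF-refl a | eqF-refl b = refl
      by-cases (no _) (yes (refl , refl))
        rewrite transpose-matchˡ a b | transpose-matchʳ a b | ltF≡true (adjacent⇒< adj) | ltF≡false σb<σa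
              | ltF≡false (adjacent⇒< adj) | reflects-false (eqF-reflects a b) (adjacent⇒≢ adj) = refl
      by-cases (no ¬ab) (no ¬ba) rewrite ltF-transpose-adjacent adj ¬ab ¬ba = cong (_+ inversion σ i j) (sym δ≡0)
        where
        δ≡0 : δab i j ≡ 0
        δ≡0 with eqF a i | eqF-reflects a i
        ... | false | _ = refl
        ... | true | ofʸ refl = cong fromBool (reflects-false (eqF-reflects b j) (λ b≡j → ¬ab (refl , sym b≡j)))

    inversionCount-descent : inversionCount σ ≡ suc (inversionCount (σ ∘ τ))
    inversionCount-descent = begin
      inversionCount σ
        ≡⟨ sum-cong-≗ (λ i → trans (sum-cong-≗ (inversion-split i)) (∑-distrib-+ (δab i) (inversion′ i))) ⟩
      ∑ (λ i → ∑ (δab i) + ∑ (inversion′ i))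
        ≡⟨ ∑-distrib-+ (λ i → ∑ (δab i)) (λ i → ∑ (inversion′ i)) ⟩
      ∑ (λ i → ∑ (δab i)) + ∑ (λ i → ∑ (inversion′ i))
        ≡⟨ cong₂ _+_ ∑∑δ≡1 (sym reindex) ⟩
      suc (inversionCount (σ ∘ τ)) ∎
      where
      open ≡-Reasoning
      inversion′ : Fin n → Fin n → ℕ
      inversion′ i j = inversion (σ ∘ τ) (τ i) (τ j)
      ∑∑δ≡1 : ∑ (λ i → ∑ (δab i)) ≡ 1
      ∑∑δ≡1 = trans (sum-cong-≗ (λ i → ∑-if (eqF a i) (fromBool ∘ eqF b))) (trans (∑-δ a _) (∑-δ b _))
      reindex : inversionCount (σ ∘ τ) ≡ ∑ (λ i → ∑ (inversion′ i))
      reindex = trans (∑-transpose (λ i → ∑ (inversion (σ ∘ τ) i)) a b)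
                      (sum-cong-≗ (λ i → ∑-transpose (inversion (σ ∘ τ) (τ i)) a b))

  inversionCount-id : (σ : Fin n → Fin n) → (∀ i → σ i ≡ i) → inversionCount σ ≡ 0
  inversionCount-id {n} σ σ≗id =
    trans (sum-cong-≗ (λ i → trans (sum-cong-≗ (no-inversion i)) (sum-replicate-zero n))) (sum-replicate-zero n)
    where
    no-inversion : ∀ i j → inversion σ i j ≡ 0
    no-inversion i j with ltF i j | ltF-reflects i j
    ... | false | _ = refl
    ... | true | ofʸ i<j rewrite σ≗id i | σ≗id j | ltF≡false i<j = refl

  ascending⇒id : (f : Fin n → Fin n) → (∀ {a b} → Adjacent a b → f a < f b) → ∀ k → f k ≡ k
  ascending⇒id {zero} f ascending ()
  ascending⇒id {suc n} f ascending k = toℕ-injective (ℕₚ.≤-antisym (upper k) (lower k))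
    where
    step : ∀ i → toℕ (f (inject₁ i)) ℕ.< toℕ (f (suc i))
    step i = ascending (cong suc (sym (toℕ-inject₁ i)))
    lower : ∀ k → toℕ k ≤ toℕ (f k)
    lower = <-weakInduction (λ k → toℕ k ≤ toℕ (f k)) z≤n
      (λ i ih → ℕₚ.≤-trans (s≤s (subst (_≤ toℕ (f (inject₁ i))) (toℕ-inject₁ i) ih)) (step i))
    upper : ∀ k → toℕ (f k) ≤ toℕ k
    upper = >-weakInduction (λ k → toℕ (f k) ≤ toℕ k)
      (subst (toℕ (f (fromℕ n)) ≤_) (sym (toℕ-fromℕ n)) (ℕₚ.≤-pred (toℕ<n (f (fromℕ n)))))
      (λ i ih → subst (toℕ (f (inject₁ i)) ≤_) (sym (toℕ-inject₁ i)) (ℕₚ.≤-pred (ℕₚ.<-≤-trans (step i) ih)))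

  Descent : (Fin n → Fin n) → Set
  Descent σ = ∃₂ λ a b → Adjacent a b × σ b < σ a

  descent? : (σ : Fin n → Fin n) → Dec (Descent σ)
  descent? σ = Finₚ.any? λ a → Finₚ.any? λ b → (toℕ b ℕ.≟ suc (toℕ a)) ×-dec (σ b Fin.<? σ a)

  no-descent⇒id : (σ : Fin n → Fin n) → Injective _≡_ _≡_ σ → ¬ Descent σ → ∀ k → σ k ≡ k
  no-descent⇒id σ inj ¬descent = ascending⇒id σ λ {a} {b} adj →
    ℕₚ.≤∧≢⇒< (ℕₚ.≮⇒≥ (λ σb<σa → ¬descent (a , b , adj , σb<σa))) (adjacent⇒≢ adj ∘ inj ∘ toℕ-injective)

  ∘-transpose-injective : (σ : Fin n → Fin n) (a b : Fin n) →
                          Injective _≡_ _≡_ σ → Injective _≡_ _≡_ (σ ∘ transpose a b)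
  ∘-transpose-injective σ a b inj {i} {j} eq = trans (transpose-preimage (inj eq)) (transpose-involutive a b j)

  module _ {ℓ} (Q : (Fin n → Fin n) → ℕ → Set ℓ)
           (base : ∀ σ → (∀ i → σ i ≡ i) → Q σ 0)
           (step : ∀ σ a b c → Adjacent a b → Q (σ ∘ transpose a b) c → Q σ (suc c)) where

    bubble-induction : ∀ σ → Injective _≡_ _≡_ σ → Q σ (inversionCount σ)
    bubble-induction σ inj = go (inversionCount σ) σ inj refl
      where
      go : ∀ c σ → Injective _≡_ _≡_ σ → inversionCount σ ≡ c → Q σ c
      go c σ inj count≡c with descent? σ
      ... | no ¬descent = subst (Q σ) (trans (sym (inversionCount-id σ σ≗id)) count≡c) (base σ σ≗id)
        where σ≗id = no-descent⇒id σ inj ¬descent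
      go zero σ inj count≡0 | yes (a , b , adj , σb<σa) =
        contradiction (trans (sym count≡0) (inversionCount-descent σ adj σb<σa)) ℕₚ.0≢1+n
      go (suc c) σ inj count≡c | yes (a , b , adj , σb<σa) =
        step σ a b c adj (go c (σ ∘ transpose a b) (∘-transpose-injective σ a b inj)
          (ℕₚ.suc-injective (trans (sym (inversionCount-descent σ adj σb<σa)) count≡c)))

  foldr-∧⇒All : ∀ {a} {A : Set a} (p : A → Bool) (xs : List A) →
                T (List.foldr (λ x b → p x ∧ b) true xs) → All (T ∘ p) xs
  foldr-∧⇒All p [] _ = []
  foldr-∧⇒All p (x ∷ xs) t with Equivalence.to T-∧ t
  ... | px , pxs = px ∷ foldr-∧⇒All p xs pxs

  ∈-pairs : {i j : Fin n} → i < j → (i , j) ∈ pairs n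
  ∈-pairs {n} {i} {j} i<j = ∈-filter⁺ (λ x → T? (ltF (proj₁ x) (proj₂ x)))
    (∈-concatMap⁺ (λ k → map (k ,_) (allFin n))
      (Any.map (λ { refl → ∈-map⁺ (i ,_) (∈-allFin j) }) (∈-allFin i)))
    (ℕₚ.<⇒<ᵇ i<j)

  isInjective⇒injective : (σ : Fin n → Fin n) → T (isInjective σ) → Injective _≡_ _≡_ σ
  isInjective⇒injective {n} σ t = injective
    where
    distinct : All (λ x → T (not (eqF (σ (proj₁ x)) (σ (proj₂ x))))) (pairs n)
    distinct = foldr-∧⇒All _ (pairs n) t
    ordered : ∀ {i j} → i < j → σ i ≢ σ j
    ordered i<j σi≡σj = subst (T ∘ not) (reflects-true (eqF-reflects _ _) σi≡σj) (All.lookup distinct (∈-pairs i<j))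
    injective : Injective _≡_ _≡_ σ
    injective {i} {j} σi≡σj with Finₚ.<-cmp i j
    ... | tri< i<j _ _ = contradiction σi≡σj (ordered i<j)
    ... | tri≈ _ i≡j _ = i≡j
    ... | tri> _ _ j<i = contradiction (sym σi≡σj) (ordered j<i)

  -- For a permutation σ this is m ∘ σ⁻¹, the exponent vector of Π_i x_(σ i)^(m i).
  pushforward : (Fin n → Fin n) → (Fin n → ℕ) → Fin n → ℕ
  pushforward σ m k = ∑ (λ i → if eqF k (σ i) then m i else 0)

  pushforward-id : (σ : Fin n → Fin n) → (∀ i → σ i ≡ i) → ∀ m k → pushforward σ m k ≡ m k
  pushforward-id σ σ≗id m k = trans (sum-cong-≗ (λ i → cong (λ j → if eqF k j then m i else 0) (σ≗id i))) (∑-δ k m)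

  pushforward-transpose : (σ : Fin n → Fin n) (m : Fin n → ℕ) (a b : Fin n) →
                          ∀ k → pushforward σ m k ≡ pushforward (σ ∘ transpose a b) (m ∘ transpose a b) k
  pushforward-transpose σ m a b k = ∑-transpose (λ i → if eqF k (σ i) then m i else 0) a b


open Permutations

module Functionals {c ℓ : Level} (R : CommutativeRing c ℓ) where

  open Poly R hiding (zero)
  open import Relation.Binary.Reasoning.Setoid setoid
  open RingProperties ring using (-1*x≈-x)
  open AbelianGroupProperties +-abelianGroup using (⁻¹-∙-comm; x∙y⁻¹≈ε⇒x≈y)
  open CommSemigroupProperties *-commutativeSemigroup using (x∙yz≈y∙xz)
  open CommSemigroupProperties +-commutativeSemigroup using (interchange)

  private variable
    n m : ℕ

  infixl 6 _⊕_
  _⊕_ : Vec ℕ n → Vec ℕ n → Vec ℕ n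
  _⊕_ = zipWith ℕ._+_

  ⊕-comm : (e f : Vec ℕ n) → e ⊕ f ≡ f ⊕ e
  ⊕-comm e f = Pointwise-≡⇒≡ (zipWith-comm ℕₚ.+-comm e f)

  ⊕-assoc : (e f g : Vec ℕ n) → e ⊕ f ⊕ g ≡ e ⊕ (f ⊕ g)
  ⊕-assoc e f g = Pointwise-≡⇒≡ (zipWith-assoc ℕₚ.+-assoc e f g)

  ⊕-identityˡ : (e : Vec ℕ n) → replicate n 0 ⊕ e ≡ e
  ⊕-identityˡ e = Pointwise-≡⇒≡ (zipWith-identityˡ ℕₚ.+-identityˡ e)

  ev : Pol n → (Vec ℕ n → Carrier) → Carrier
  ev [] h = 0#
  ev ((a , e) ∷ p) h = a * h e + ev p h

  ev-cong : (p : Pol n) {h h′ : Vec ℕ n → Carrier} → (∀ e → h e ≈ h′ e) → ev p h ≈ ev p h′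
  ev-cong [] h≈h′ = refl
  ev-cong ((a , e) ∷ p) h≈h′ = +-cong (*-congˡ (h≈h′ e)) (ev-cong p h≈h′)

  ev-≡ : (p : Pol n) {h h′ : Vec ℕ n → Carrier} → (∀ e → h e ≡ h′ e) → ev p h ≈ ev p h′
  ev-≡ p h≡h′ = ev-cong p (reflexive ∘ h≡h′)

  ev-0ᶠ : (p : Pol n) → ev p (λ _ → 0#) ≈ 0#
  ev-0ᶠ [] = refl
  ev-0ᶠ ((a , e) ∷ p) = trans (+-cong (zeroʳ a) (ev-0ᶠ p)) (+-identityˡ 0#)

  ev-+ᶠ : (p : Pol n) (h h′ : Vec ℕ n → Carrier) → ev p (λ e → h e + h′ e) ≈ ev p h + ev p h′
  ev-+ᶠ [] h h′ = sym (+-identityˡ 0#)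
  ev-+ᶠ ((a , e) ∷ p) h h′ = trans (+-cong (distribˡ a (h e) (h′ e)) (ev-+ᶠ p h h′)) (interchange _ _ _ _)

  ev-*ᶠ : (p : Pol n) (r : Carrier) (h : Vec ℕ n → Carrier) → ev p (λ e → r * h e) ≈ r * ev p h
  ev-*ᶠ [] r h = sym (zeroʳ r)
  ev-*ᶠ ((a , e) ∷ p) r h = trans (+-cong (x∙yz≈y∙xz a r (h e)) (ev-*ᶠ p r h)) (sym (distribˡ r _ _))

  ev-++ : (p q : Pol n) (h : Vec ℕ n → Carrier) → ev (p ++ q) h ≈ ev p h + ev q h
  ev-++ [] q h = sym (+-identityˡ _)
  ev-++ ((a , e) ∷ p) q h = trans (+-congˡ (ev-++ p q h)) (sym (+-assoc _ _ _))

  ev-scaleP : (r : Carrier) (p : Pol n) (h : Vec ℕ n → Carrier) → ev (scaleP r p) h ≈ r * ev p h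
  ev-scaleP r [] h = sym (zeroʳ r)
  ev-scaleP r ((a , e) ∷ p) h = trans (+-cong (*-assoc r a (h e)) (ev-scaleP r p h)) (sym (distribˡ r _ _))

  ev--P : (p q : Pol n) (h : Vec ℕ n → Carrier) → ev (p -P q) h ≈ ev p h - ev q h
  ev--P p q h = trans (ev-++ p _ h) (+-congˡ (trans (ev-scaleP (- 1#) q h) (-1*x≈-x _)))

  ev-constP : (r : Carrier) (h : Vec ℕ n → Carrier) → ev (constP r) h ≈ r * h (replicate n 0)
  ev-constP r h = +-identityʳ _

  ev-*P : (p q : Pol n) (h : Vec ℕ n → Carrier) → ev (p *P q) h ≈ ev p (λ e → ev q (λ f → h (e ⊕ f)))
  ev-*P [] q h = refl
  ev-*P ((a , e) ∷ p) q h = trans (ev-++ (shifted q) (p *P q) h) (+-cong (ev-shifted q) (ev-*P p q h))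
    where
    shifted : Pol _ → Pol _
    shifted = List.map λ (b , f) → (a * b , e ⊕ f)
    ev-shifted : ∀ q → ev (shifted q) h ≈ a * ev q (λ f → h (e ⊕ f))
    ev-shifted [] = sym (zeroʳ a)
    ev-shifted ((b , f) ∷ q) = trans (+-cong (*-assoc a b _) (ev-shifted q)) (sym (distribˡ a _ _))

  ev-comm : (p : Pol n) (q : Pol m) (g : Vec ℕ n → Vec ℕ m → Carrier) →
            ev p (λ e → ev q (g e)) ≈ ev q (λ f → ev p (λ e → g e f))
  ev-comm [] q g = sym (ev-0ᶠ q)
  ev-comm ((a , e) ∷ p) q g = begin
    a * ev q (g e) + ev p (λ e′ → ev q (g e′))
      ≈⟨ +-cong (sym (ev-*ᶠ q a (g e))) (ev-comm p q g) ⟩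
    ev q (λ f → a * g e f) + ev q (λ f → ev p (λ e′ → g e′ f))
      ≈⟨ ev-+ᶠ q _ _ ⟨
    ev q (λ f → a * g e f + ev p (λ e′ → g e′ f)) ∎

  ev-sumP-map : ∀ {a} {A : Set a} (F : A → Pol n) (xs : List A) (h : Vec ℕ n → Carrier) →
                ev (sumP (List.map F xs)) h ≈ sumR (List.map (λ x → ev (F x) h) xs)
  ev-sumP-map F [] h = refl
  ev-sumP-map F (x ∷ xs) h = trans (ev-++ (F x) _ h) (+-congˡ (ev-sumP-map F xs h))

  ev-linearExtension : (F : Vec ℕ n → Pol m) (Q : Pol n) (h : Vec ℕ m → Carrier) →
                       ev (sumP (List.map (λ (a , e) → scaleP a (F e)) Q)) h ≈ ev Q (λ e → ev (F e) h)
  ev-linearExtension F [] h = refl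
  ev-linearExtension F ((a , e) ∷ Q) h =
    trans (ev-++ (scaleP a (F e)) _ h) (+-cong (ev-scaleP a (F e) h) (ev-linearExtension F Q h))

  infix 4 _≃_
  record _≃_ (p q : Pol n) : Set (c ⊔ ℓ) where
    constructor mk≃
    field ev≈ : ∀ h → ev p h ≈ ev q h
  open _≃_ public

  ≃-refl : {p : Pol n} → p ≃ p
  ≃-refl = mk≃ λ h → refl

  ≃-sym : {p q : Pol n} → p ≃ q → q ≃ p
  ≃-sym p≃q = mk≃ λ h → sym (ev≈ p≃q h)

  ≃-trans : {p q r : Pol n} → p ≃ q → q ≃ r → p ≃ r
  ≃-trans p≃q q≃r = mk≃ λ h → trans (ev≈ p≃q h) (ev≈ q≃r h)

  ≡⇒≃ : {p q : Pol n} → p ≡ q → p ≃ q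
  ≡⇒≃ ≡.refl = ≃-refl

  *P-cong : {p p′ q q′ : Pol n} → p ≃ p′ → q ≃ q′ → p *P q ≃ p′ *P q′
  *P-cong {p = p} {p′} {q} {q′} p≃p′ q≃q′ = mk≃ λ h → begin
    ev (p *P q) h                                  ≈⟨ ev-*P p q h ⟩
    ev p (λ e → ev q (λ f → h (e ⊕ f)))            ≈⟨ ev≈ p≃p′ _ ⟩
    ev p′ (λ e → ev q (λ f → h (e ⊕ f)))           ≈⟨ ev-cong p′ (λ e → ev≈ q≃q′ _) ⟩
    ev p′ (λ e → ev q′ (λ f → h (e ⊕ f)))          ≈⟨ ev-*P p′ q′ h ⟨
    ev (p′ *P q′) h                                ∎

  *P-comm : (p q : Pol n) → p *P q ≃ q *P p
  *P-comm p q = mk≃ λ h → begin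
    ev (p *P q) h                                  ≈⟨ ev-*P p q h ⟩
    ev p (λ e → ev q (λ f → h (e ⊕ f)))            ≈⟨ ev-comm p q _ ⟩
    ev q (λ f → ev p (λ e → h (e ⊕ f)))            ≈⟨ ev-cong q (λ f → ev-≡ p (λ e → ≡.cong h (⊕-comm e f))) ⟩
    ev q (λ f → ev p (λ e → h (f ⊕ e)))            ≈⟨ ev-*P q p h ⟨
    ev (q *P p) h                                  ∎

  *P-assoc : (p q r : Pol n) → p *P q *P r ≃ p *P (q *P r)
  *P-assoc p q r = mk≃ λ h → begin
    ev (p *P q *P r) h
      ≈⟨ ev-*P (p *P q) r h ⟩
    ev (p *P q) (λ u → ev r (λ g → h (u ⊕ g)))
      ≈⟨ ev-*P p q _ ⟩
    ev p (λ e → ev q (λ f → ev r (λ g → h (e ⊕ f ⊕ g))))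
      ≈⟨ ev-cong p (λ e → ev-cong q (λ f → ev-≡ r (λ g → ≡.cong h (⊕-assoc e f g)))) ⟩
    ev p (λ e → ev q (λ f → ev r (λ g → h (e ⊕ (f ⊕ g)))))
      ≈⟨ ev-cong p (λ e → ev-*P q r _) ⟨
    ev p (λ e → ev (q *P r) (λ u → h (e ⊕ u)))
      ≈⟨ ev-*P p (q *P r) h ⟨
    ev (p *P (q *P r)) h                                          ∎

  ev-constP-*P : (r : Carrier) (q : Pol n) (h : Vec ℕ n → Carrier) → ev (constP r *P q) h ≈ r * ev q h
  ev-constP-*P {n} r q h = begin
    ev (constP r *P q) h                           ≈⟨ ev-*P (constP r) q h ⟩
    r * ev q (λ f → h (replicate n 0 ⊕ f)) + 0#    ≈⟨ +-identityʳ _ ⟩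
    r * ev q (λ f → h (replicate n 0 ⊕ f))         ≈⟨ *-congˡ (ev-≡ q (≡.cong h ∘ ⊕-identityˡ)) ⟩
    r * ev q h                                     ∎

  *P-identityˡ : (q : Pol n) → constP 1# *P q ≃ q
  *P-identityˡ q = mk≃ λ h → trans (ev-constP-*P 1# q h) (*-identityˡ _)

  *P-identityʳ : (q : Pol n) → q *P constP 1# ≃ q
  *P-identityʳ q = ≃-trans (*P-comm q (constP 1#)) (*P-identityˡ q)

  *P-commutativeMonoid : ℕ → CommutativeMonoid c (c ⊔ ℓ)
  *P-commutativeMonoid n = record
    { Carrier = Pol n
    ; _≈_ = _≃_
    ; _∙_ = _*P_
    ; ε = constP 1#
    ; isCommutativeMonoid = record
      { isMonoid = record
        { isSemigroup = record
          { isMagma = record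
            { isEquivalence = record { refl = ≃-refl ; sym = ≃-sym ; trans = ≃-trans }
            ; ∙-cong = *P-cong }
          ; assoc = *P-assoc }
        ; identity = *P-identityˡ , *P-identityʳ }
      ; comm = *P-comm } }

  -P-cong : {p p′ q q′ : Pol n} → p ≃ p′ → q ≃ q′ → p -P q ≃ p′ -P q′
  -P-cong {p = p} {p′} {q} {q′} p≃p′ q≃q′ = mk≃ λ h →
    trans (ev--P p q h) (trans (+-cong (ev≈ p≃p′ h) (-‿cong (ev≈ q≃q′ h))) (sym (ev--P p′ q′ h)))

  *P-scaleP : (r : Carrier) (p q : Pol n) → p *P scaleP r q ≃ scaleP r (p *P q)
  *P-scaleP r p q = mk≃ λ h → begin
    ev (p *P scaleP r q) h                       ≈⟨ ev-*P p (scaleP r q) h ⟩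
    ev p (λ e → ev (scaleP r q) (λ f → h (e ⊕ f))) ≈⟨ ev-cong p (λ e → ev-scaleP r q _) ⟩
    ev p (λ e → r * ev q (λ f → h (e ⊕ f)))      ≈⟨ ev-*ᶠ p r _ ⟩
    r * ev p (λ e → ev q (λ f → h (e ⊕ f)))      ≈⟨ *-congˡ (ev-*P p q h) ⟨
    r * ev (p *P q) h                            ≈⟨ ev-scaleP r (p *P q) h ⟨
    ev (scaleP r (p *P q)) h                     ∎

  δ : Vec ℕ n → Vec ℕ n → Carrier
  δ e f = if eqV f e then 1# else 0#

  coeff-ev : (p : Pol n) (e : Vec ℕ n) → coeff p e ≈ ev p (δ e)
  coeff-ev [] e = refl
  coeff-ev ((a , f) ∷ p) e with eqV f e
  ... | true = +-cong (sym (*-identityʳ a)) (coeff-ev p e)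
  ... | false = trans (coeff-ev p e) (sym (trans (+-congʳ (zeroʳ a)) (+-identityˡ _)))

  ≃⇒≈P : {p q : Pol n} → p ≃ q → p ≈P q
  ≃⇒≈P {p = p} {q} p≃q e = trans (coeff-ev p e) (trans (ev≈ p≃q (δ e)) (sym (coeff-ev q e)))

  -- Induction on p, after splitting h = h′ + h e · δ e where h′ vanishes at the first exponent e of p.
  ev-coeff-vanishing : (p : Pol n) (h : Vec ℕ n → Carrier) → (∀ e → coeff p e * h e ≈ 0#) → ev p h ≈ 0#
  ev-coeff-vanishing [] h vanish = refl
  ev-coeff-vanishing p@((a , e) ∷ p′) h vanish = begin
    ev p h
      ≈⟨ ev-cong p split ⟩
    ev p (λ f → h′ f + h e * δ e f)
      ≈⟨ ev-+ᶠ p h′ _ ⟩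
    ev p h′ + ev p (λ f → h e * δ e f)
      ≈⟨ +-congˡ (ev-*ᶠ p (h e) (δ e)) ⟩
    ev p h′ + h e * ev p (δ e)
      ≈⟨ +-congˡ (trans (*-congˡ (sym (coeff-ev p e))) (trans (*-comm _ _) (vanish e))) ⟩
    ev p h′ + 0#
      ≈⟨ +-identityʳ _ ⟩
    a * h′ e + ev p′ h′
      ≈⟨ +-congʳ (trans (*-congˡ h′e≈0) (zeroʳ a)) ⟩
    0# + ev p′ h′
      ≈⟨ +-identityˡ _ ⟩
    ev p′ h′
      ≈⟨ ev-coeff-vanishing p′ h′ vanish′ ⟩
    0#                                       ∎
    where
    h′ : Vec ℕ _ → Carrier
    h′ f = if eqV f e then 0# else h f
    h′e≈0 : h′ e ≈ 0#
    h′e≈0 with eqV e e | eqV-reflects e e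
    ... | true | _ = refl
    ... | false | ofⁿ e≢e = ⊥-elim (e≢e ≡.refl)
    split : ∀ f → h f ≈ h′ f + h e * δ e f
    split f with eqV f e | eqV-reflects f e
    ... | true | ofʸ ≡.refl = sym (trans (+-identityˡ _) (*-identityʳ _))
    ... | false | _ = sym (trans (+-congˡ (zeroʳ _)) (+-identityʳ _))
    vanish′ : ∀ f → coeff p′ f * h′ f ≈ 0#
    vanish′ f with eqV f e | eqV-reflects f e | vanish f
    ... | true | _ | _ = zeroʳ _
    ... | false | ofⁿ f≢e | vanish-f with eqV e f | eqV-reflects e f
    ...   | false | _ = vanish-f
    ...   | true | ofʸ e≡f = ⊥-elim (f≢e (≡.sym e≡f))

  ≈P⇒≃ : {p q : Pol n} → p ≈P q → p ≃ q
  ≈P⇒≃ {p = p} {q} p≈q = mk≃ λ h → x∙y⁻¹≈ε⇒x≈y _ _ (begin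
    ev p h - ev q h   ≈⟨ ev--P p q h ⟨
    ev (p -P q) h     ≈⟨ ev-coeff-vanishing (p -P q) h (λ e → trans (*-congʳ (coeff-difference e)) (zeroˡ _)) ⟩
    0#                ∎)
    where
    coeff-difference : ∀ e → coeff (p -P q) e ≈ 0#
    coeff-difference e = begin
      coeff (p -P q) e              ≈⟨ coeff-ev (p -P q) e ⟩
      ev (p -P q) (δ e)             ≈⟨ ev--P p q (δ e) ⟩
      ev p (δ e) - ev q (δ e)       ≈⟨ +-cong (coeff-ev p e) (-‿cong (coeff-ev q e)) ⟨
      coeff p e - coeff q e         ≈⟨ +-congʳ (p≈q e) ⟩
      coeff q e - coeff q e         ≈⟨ -‿inverseʳ _ ⟩
      0#                            ∎

  module ∏ {n : ℕ} = MonoidSum (*P-commutativeMonoid n)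

  prodP≡∏ : ∀ k (F : Fin k → Pol n) → prodP k F ≡ ∏.sum F
  prodP≡∏ zero F = ≡.refl
  prodP≡∏ (suc k) F = ≡.cong (F zero *P_) (prodP≡∏ k (F ∘ suc))

  prodP-cong : ∀ k {F G : Fin k → Pol n} → (∀ i → F i ≃ G i) → prodP k F ≃ prodP k G
  prodP-cong zero F≃G = ≃-refl
  prodP-cong (suc k) F≃G = *P-cong (F≃G zero) (prodP-cong k (F≃G ∘ suc))

  prodP-*P : ∀ k (F G : Fin k → Pol n) → prodP k (λ i → F i *P G i) ≃ prodP k F *P prodP k G
  prodP-*P k F G rewrite prodP≡∏ k (λ i → F i *P G i) | prodP≡∏ k F | prodP≡∏ k G = ∏.∑-distrib-+ F G

  prodP-transpose : ∀ k (F : Fin k → Pol n) (a b : Fin k) → prodP k F ≃ prodP k (F ∘ transpose a b)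
  prodP-transpose k F a b rewrite prodP≡∏ k F | prodP≡∏ k (F ∘ transpose a b) =
    ∏.sum-permute F (Perm.transpose a b)

  prodP-constP-1# : ∀ k → prodP {n} k (λ _ → constP 1#) ≃ constP 1#
  prodP-constP-1# k = ≃-trans (≡⇒≃ (prodP≡∏ k (λ _ → constP 1#))) (∏.sum-replicate-zero k)

  vsum : ∀ k → (Fin k → Vec ℕ n) → Vec ℕ n
  vsum {n} zero v = replicate n 0
  vsum (suc k) v = v zero ⊕ vsum k (v ∘ suc)

  ev-prodP-singletons : ∀ k (a : Fin k → Carrier) (v : Fin k → Vec ℕ n) (h : Vec ℕ n → Carrier) →
                        ev (prodP k (λ i → (a i , v i) ∷ [])) h ≈ prodR k a * h (vsum k v)
  ev-prodP-singletons zero a v h = ev-constP 1# h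
  ev-prodP-singletons (suc k) a v h = let rest = prodP k (λ i → (a (suc i) , v (suc i)) ∷ []) in begin
    ev (((a zero , v zero) ∷ []) *P rest) h
      ≈⟨ ev-*P ((a zero , v zero) ∷ []) rest h ⟩
    a zero * ev rest (λ f → h (v zero ⊕ f)) + 0#
      ≈⟨ +-identityʳ _ ⟩
    a zero * ev rest (λ f → h (v zero ⊕ f))
      ≈⟨ *-congˡ (ev-prodP-singletons k (a ∘ suc) (v ∘ suc) _) ⟩
    a zero * (prodR k (a ∘ suc) * h (vsum (suc k) v))
      ≈⟨ *-assoc _ _ _ ⟨
    prodR (suc k) a * h (vsum (suc k) v) ∎

  lookup-vsum : ∀ k (v : Fin k → Vec ℕ n) j → lookup (vsum k v) j ≡ ∑ (λ i → lookup (v i) j)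
  lookup-vsum zero v j = Vecₚ.lookup-replicate j 0
  lookup-vsum (suc k) v j = ≡.trans (Vecₚ.lookup-zipWith ℕ._+_ j (v zero) _)
                                    (≡.cong (lookup (v zero) j ℕ.+_) (lookup-vsum k (v ∘ suc) j))

  powP-+ : (y : Pol n) (a b : ℕ) → powP y (a ℕ.+ b) ≃ powP y a *P powP y b
  powP-+ y a zero = ≃-trans (≡⇒≃ (≡.cong (powP y) (ℕₚ.+-identityʳ a))) (≃-sym (*P-identityʳ (powP y a)))
  powP-+ y a (suc b) = ≃-trans (≡⇒≃ (≡.cong (powP y) (ℕₚ.+-suc a b)))
    (≃-trans (*P-cong (powP-+ y a b) ≃-refl) (*P-assoc (powP y a) (powP y b) y))

  ffP-cong : {p q : Pol n} → ∀ r → p ≃ q → ffP p r ≃ ffP q r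
  ffP-cong zero p≃q = ≃-refl
  ffP-cong (suc r) p≃q = *P-cong (ffP-cong r p≃q) (-P-cong p≃q ≃-refl)

  constP-cong : {r s : Carrier} → r ≈ s → constP {n} r ≃ constP s
  constP-cong r≈s = mk≃ λ h → +-congʳ (*-congʳ r≈s)

  natR-+ : ∀ a b → natR (a ℕ.+ b) ≈ natR a + natR b
  natR-+ zero b = sym (+-identityˡ _)
  natR-+ (suc a) b = trans (+-congˡ (natR-+ a b)) (sym (+-assoc _ _ _))

  -P-constP-+ : (y : Pol n) (r s : Carrier) → y -P constP (r + s) ≃ y -P constP r -P constP s
  -P-constP-+ {n} y r s = mk≃ λ h → let z = h (replicate n 0) in begin
    ev (y -P constP (r + s)) h                 ≈⟨ ev--P y (constP (r + s)) h ⟩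
    ev y h - ev (constP (r + s)) h             ≈⟨ +-congˡ (-‿cong (trans (ev-constP (r + s) h) (distribʳ z r s))) ⟩
    ev y h - (r * z + s * z)                   ≈⟨ +-congˡ (⁻¹-∙-comm (r * z) (s * z)) ⟨
    ev y h + (- (r * z) + - (s * z))           ≈⟨ +-assoc _ _ _ ⟨
    ev y h - r * z - s * z                     ≈⟨ +-cong (+-congˡ (-‿cong (ev-constP r h))) (-‿cong (ev-constP s h)) ⟨
    ev y h - ev (constP r) h - ev (constP s) h ≈⟨ +-congʳ (ev--P y (constP r) h) ⟨
    ev (y -P constP r) h - ev (constP s) h     ≈⟨ ev--P (y -P constP r) (constP s) h ⟨
    ev (y -P constP r -P constP s) h           ∎

  ffP-+ : (y : Pol n) (a b : ℕ) → ffP y (a ℕ.+ b) ≃ ffP y a *P ffP (y -P constP (natR a)) b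
  ffP-+ y a zero = ≃-trans (≡⇒≃ (≡.cong (ffP y) (ℕₚ.+-identityʳ a))) (≃-sym (*P-identityʳ (ffP y a)))
  ffP-+ y a (suc b) = ≃-trans (≡⇒≃ (≡.cong (ffP y) (ℕₚ.+-suc a b)))
    (≃-trans (*P-cong (ffP-+ y a b) shift)
      (*P-assoc (ffP y a) (ffP (y -P constP (natR a)) b) ((y -P constP (natR a)) -P constP (natR b))))
    where
    shift : y -P constP (natR (a ℕ.+ b)) ≃ y -P constP (natR a) -P constP (natR b)
    shift = ≃-trans (-P-cong ≃-refl (constP-cong (natR-+ a b))) (-P-constP-+ y (natR a) (natR b))

  monomial : (Fin n → Pol m) → Vec ℕ n → Pol m
  monomial {n} g e = prodP n (λ k → powP (g k) (lookup e k))

  fallingMonomial : (Fin n → Pol m) → Vec ℕ n → Pol m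
  fallingMonomial {n} g e = prodP n (λ k → ffP (g k) (lookup e k))

  ev-subst : (Q : Pol n) (g : Fin n → Pol m) (h : Vec ℕ m → Carrier) →
             ev (subst Q g) h ≈ ev Q (λ e → ev (monomial g e) h)
  ev-subst Q g = ev-linearExtension (monomial g) Q

  ev-star : (Q : Pol n) (h : Vec ℕ n → Carrier) → ev (star Q) h ≈ ev Q (λ e → ev (fallingMonomial varP e) h)
  ev-star Q = ev-linearExtension (fallingMonomial varP) Q

  monomial-⊕ : (g : Fin n → Pol m) (e f : Vec ℕ n) → monomial g (e ⊕ f) ≃ monomial g e *P monomial g f
  monomial-⊕ {n} g e f = ≃-trans
    (prodP-cong n λ k → ≃-trans (≡⇒≃ (≡.cong (powP (g k)) (Vecₚ.lookup-zipWith ℕ._+_ k e f)))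
                                (powP-+ (g k) (lookup e k) (lookup f k)))
    (prodP-*P n (λ k → powP (g k) (lookup e k)) (λ k → powP (g k) (lookup f k)))

  monomial-0 : (g : Fin n → Pol m) → monomial g (replicate n 0) ≃ constP 1#
  monomial-0 {n} g = ≃-trans (prodP-cong n λ k → ≡⇒≃ (≡.cong (powP (g k)) (Vecₚ.lookup-replicate k 0)))
                             (prodP-constP-1# n)

  module _ (g : Fin n → Pol m) where

    subst-*P : (p q : Pol n) → subst (p *P q) g ≃ subst p g *P subst q g
    subst-*P p q = mk≃ λ h → let M = λ e → ev (monomial g e) in begin
      ev (subst (p *P q) g) h
        ≈⟨ ev-subst (p *P q) g h ⟩
      ev (p *P q) (λ e → M e h)
        ≈⟨ ev-*P p q _ ⟩
      ev p (λ e → ev q (λ f → M (e ⊕ f) h))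
        ≈⟨ ev-cong p (λ e → ev-cong q (λ f → ev≈ (monomial-⊕ g e f) h)) ⟩
      ev p (λ e → ev q (λ f → ev (monomial g e *P monomial g f) h))
        ≈⟨ ev-cong p (λ e → ev-cong q (λ f → ev-*P (monomial g e) (monomial g f) h)) ⟩
      ev p (λ e → ev q (λ f → M e (λ u → M f (λ v → h (u ⊕ v)))))
        ≈⟨ ev-cong p (λ e → ev-comm (monomial g e) q _) ⟨
      ev p (λ e → M e (λ u → ev q (λ f → M f (λ v → h (u ⊕ v)))))
        ≈⟨ ev-subst p g _ ⟨
      ev (subst p g) (λ u → ev q (λ f → M f (λ v → h (u ⊕ v))))
        ≈⟨ ev-cong (subst p g) (λ u → ev-subst q g _) ⟨
      ev (subst p g) (λ u → ev (subst q g) (λ v → h (u ⊕ v)))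
        ≈⟨ ev-*P (subst p g) (subst q g) h ⟨
      ev (subst p g *P subst q g) h                                          ∎

    subst-constP : (r : Carrier) → subst (constP r) g ≃ constP r
    subst-constP r = mk≃ λ h → begin
      ev (subst (constP r) g) h                   ≈⟨ ev-subst (constP r) g h ⟩
      r * ev (monomial g (replicate n 0)) h + 0#  ≈⟨ +-identityʳ _ ⟩
      r * ev (monomial g (replicate n 0)) h       ≈⟨ *-congˡ (ev≈ (monomial-0 g) h) ⟩
      r * ev (constP 1#) h                        ≈⟨ *-congˡ (trans (ev-constP 1# h) (*-identityˡ _)) ⟩
      r * h (replicate m 0)                       ≈⟨ ev-constP r h ⟨
      ev (constP r) h                             ∎

    subst--P : (p q : Pol n) → subst (p -P q) g ≃ subst p g -P subst q g
    subst--P p q = mk≃ λ h → begin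
      ev (subst (p -P q) g) h
        ≈⟨ ev-subst (p -P q) g h ⟩
      ev (p -P q) (λ e → ev (monomial g e) h)
        ≈⟨ ev--P p q _ ⟩
      ev p (λ e → ev (monomial g e) h) - ev q (λ e → ev (monomial g e) h)
        ≈⟨ +-cong (ev-subst p g h) (-‿cong (ev-subst q g h)) ⟨
      ev (subst p g) h - ev (subst q g) h
        ≈⟨ ev--P (subst p g) (subst q g) h ⟨
      ev (subst p g -P subst q g) h                             ∎

    subst-varP : (k : Fin n) → subst (varP k) g ≃ g k
    subst-varP k = mk≃ λ h → begin
      ev (subst (varP k) g) h
        ≈⟨ ev-subst (varP k) g h ⟩
      1# * ev (monomial g unit) h + 0#
        ≈⟨ trans (+-identityʳ _) (*-identityˡ _) ⟩
      ev (monomial g unit) h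
        ≈⟨ ev≈ (prodP-cong n λ l → ≡⇒≃ (≡.cong (powP (g l)) (Vecₚ.lookup∘tabulate _ l))) h ⟩
      ev (prodP n (λ l → powP (g l) (if eqF l k then 1 else 0))) h
        ≈⟨ ev≈ (unitProduct g k) h ⟩
      ev (g k) h                                  ∎
      where
      unit : Vec ℕ n
      unit = tabulate (λ i → if eqF i k then 1 else 0)
      unitProduct : ∀ {n} (g : Fin n → Pol m) k → prodP n (λ l → powP (g l) (if eqF l k then 1 else 0)) ≃ g k
      unitProduct {suc n} g zero =
        ≃-trans (*P-cong (*P-identityˡ (g zero)) (prodP-constP-1# n)) (*P-identityʳ (g zero))
      unitProduct {suc n} g (suc k) = ≃-trans (*P-identityˡ _) (unitProduct (g ∘ suc) k)

    subst-ffP : (y : Pol n) (r : ℕ) → subst (ffP y r) g ≃ ffP (subst y g) r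
    subst-ffP y zero = subst-constP 1#
    subst-ffP y (suc r) = ≃-trans (subst-*P (ffP y r) (y -P constP (natR r)))
      (*P-cong (subst-ffP y r) (≃-trans (subst--P y (constP (natR r))) (-P-cong ≃-refl (subst-constP (natR r)))))

    subst-prodP : ∀ k (F : Fin k → Pol n) → subst (prodP k F) g ≃ prodP k (λ i → subst (F i) g)
    subst-prodP zero F = subst-constP 1#
    subst-prodP (suc k) F = ≃-trans (subst-*P (F zero) (prodP k (F ∘ suc)))
                                   (*P-cong (≃-refl {p = subst (F zero) g}) (subst-prodP k (F ∘ suc)))

    subst-fallingMonomial : (e : Vec ℕ n) → subst (fallingMonomial varP e) g ≃ fallingMonomial g e
    subst-fallingMonomial e = ≃-trans (subst-prodP n _)
      (prodP-cong n λ k → ≃-trans (subst-ffP (varP k) (lookup e k)) (ffP-cong (lookup e k) (subst-varP k)))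

    ev-subst-star : (Q : Pol n) (h : Vec ℕ m → Carrier) →
                    ev (subst (star Q) g) h ≈ ev Q (λ e → ev (fallingMonomial g e) h)
    ev-subst-star Q h = begin
      ev (subst (star Q) g) h
        ≈⟨ ev-subst (star Q) g h ⟩
      ev (star Q) (λ e → ev (monomial g e) h)
        ≈⟨ ev-star Q _ ⟩
      ev Q (λ e → ev (fallingMonomial varP e) (λ e′ → ev (monomial g e′) h))
        ≈⟨ ev-cong Q (λ e → ev-subst (fallingMonomial varP e) g h) ⟨
      ev Q (λ e → ev (subst (fallingMonomial varP e) g) h)
        ≈⟨ ev-cong Q (λ e → ev≈ (subst-fallingMonomial e) h) ⟩
      ev Q (λ e → ev (fallingMonomial g e) h)                              ∎

  ev-swapVars : (i j : Fin n) (Q : Pol n) (h : Vec ℕ n → Carrier) →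
                ev (swapVars i j Q) h ≈ ev Q (λ e → h (tabulate (λ k → lookup e (transpose i j k))))
  ev-swapVars i j [] h = refl
  ev-swapVars i j ((a , e) ∷ Q) h = +-congˡ (ev-swapVars i j Q h)

  subst-star-cong : {Q Q′ : Pol n} {g g′ : Fin n → Pol m} → Q ≃ Q′ → (∀ k → g k ≃ g′ k) →
                    subst (star Q) g ≃ subst (star Q′) g′
  subst-star-cong {n} {Q = Q} {Q′} {g} {g′} Q≃Q′ g≃g′ = mk≃ λ h → begin
    ev (subst (star Q) g) h
      ≈⟨ ev-subst-star g Q h ⟩
    ev Q (λ e → ev (fallingMonomial g e) h)
      ≈⟨ ev≈ Q≃Q′ _ ⟩
    ev Q′ (λ e → ev (fallingMonomial g e) h)
      ≈⟨ ev-cong Q′ (λ e → ev≈ (prodP-cong n λ k → ffP-cong (lookup e k) (g≃g′ k)) h) ⟩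
    ev Q′ (λ e → ev (fallingMonomial g′ e) h)
      ≈⟨ ev-subst-star g′ Q′ h ⟨
    ev (subst (star Q′) g′) h                    ∎

  module _ (g : Fin n → Pol m) where

    subst-star-scaleP : (r : Carrier) (Q : Pol n) → subst (star (scaleP r Q)) g ≃ scaleP r (subst (star Q) g)
    subst-star-scaleP r Q = mk≃ λ h → begin
      ev (subst (star (scaleP r Q)) g) h                  ≈⟨ ev-subst-star g (scaleP r Q) h ⟩
      ev (scaleP r Q) (λ e → ev (fallingMonomial g e) h)  ≈⟨ ev-scaleP r Q _ ⟩
      r * ev Q (λ e → ev (fallingMonomial g e) h)         ≈⟨ *-congˡ (ev-subst-star g Q h) ⟨
      r * ev (subst (star Q) g) h                         ≈⟨ ev-scaleP r (subst (star Q) g) h ⟨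
      ev (scaleP r (subst (star Q) g)) h                  ∎

    subst-star-transpose : (i j : Fin n) (Q : Pol n) →
                           subst (star Q) (g ∘ transpose i j) ≃ subst (star (swapVars i j Q)) g
    subst-star-transpose i j Q = mk≃ λ h → begin
      ev (subst (star Q) (g ∘ τ)) h                               ≈⟨ ev-subst-star (g ∘ τ) Q h ⟩
      ev Q (λ e → ev (fallingMonomial (g ∘ τ) e) h)               ≈⟨ ev-cong Q (λ e → ev≈ (permuted e) h) ⟩
      ev Q (λ e → ev (fallingMonomial g (swapped e)) h)           ≈⟨ ev-swapVars i j Q _ ⟨
      ev (swapVars i j Q) (λ e → ev (fallingMonomial g e) h)      ≈⟨ ev-subst-star g (swapVars i j Q) h ⟨
      ev (subst (star (swapVars i j Q)) g) h                      ∎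
      where
      τ : Fin n → Fin n
      τ = transpose i j
      swapped : Vec ℕ n → Vec ℕ n
      swapped e = tabulate (λ k → lookup e (τ k))
      permuted : ∀ e → fallingMonomial (g ∘ τ) e ≃ fallingMonomial g (swapped e)
      permuted e = ≃-trans (prodP-transpose n _ i j) (prodP-cong n λ k → ≡⇒≃
        (≡.cong₂ (λ l r → ffP (g l) r) (transpose-involutive i j k) (≡.sym (Vecₚ.lookup∘tabulate _ k))))

module PermutationSums {c ℓ : Level} (R : CommutativeRing c ℓ) where

  open Poly R hiding (zero)
  open Exp semiring using (_^_)
  open RingProperties ring using (-1*x≈-x; -‿distribˡ-*; -‿distribʳ-*; -‿involutive)
  open import Relation.Binary.Reasoning.Setoid setoid

  sumPerms : ∀ {n} → ((Fin n → Fin n) → Carrier) → Carrier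
  sumPerms {n} f = sumR (List.map f (perms n))

  prodAlong : ∀ {n} → (Fin n → Fin n → Carrier) → (Fin n → Fin n) → Carrier
  prodAlong {n} A σ = prodR n (λ i → A i (σ i))

  ^-zeroˡ : ∀ k → 1# ^ k ≈ 1#
  ^-zeroˡ zero = refl
  ^-zeroˡ (suc k) = trans (*-identityˡ _) (^-zeroˡ k)

  foldr-negate*[-1]^length : ∀ {a} {A : Set a} (xs : List A) →
                             List.foldr (λ _ s → - s) 1# xs * (- 1#) ^ length xs ≈ 1#
  foldr-negate*[-1]^length [] = *-identityˡ 1#
  foldr-negate*[-1]^length (x ∷ xs) = begin
    - s * (- 1# * p)  ≈⟨ *-congˡ (-1*x≈-x p) ⟩
    - s * - p         ≈⟨ -‿distribˡ-* s (- p) ⟨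
    - (s * - p)       ≈⟨ -‿cong (-‿distribʳ-* s p) ⟨
    - - (s * p)       ≈⟨ -‿involutive _ ⟩
    s * p             ≈⟨ foldr-negate*[-1]^length xs ⟩
    1#                ∎
    where
    s = List.foldr (λ _ s → - s) 1# xs
    p = (- 1#) ^ length xs

  sumR-cong : ∀ {a} {A : Set a} {f g : A → Carrier} {xs : List A} →
              All (λ x → f x ≈ g x) xs → sumR (List.map f xs) ≈ sumR (List.map g xs)
  sumR-cong [] = refl
  sumR-cong (fx≈gx ∷ fxs≈gxs) = +-cong fx≈gx (sumR-cong fxs≈gxs)

  sumR-*ʳ : ∀ {a} {A : Set a} (f : A → Carrier) (xs : List A) (t : Carrier) →
            sumR (List.map (λ x → f x * t) xs) ≈ sumR (List.map f xs) * t
  sumR-*ʳ f [] t = sym (zeroˡ t)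
  sumR-*ʳ f (x ∷ xs) t = trans (+-congˡ (sumR-*ʳ f xs t)) (sym (distribʳ t _ _))

  signed-sum : ∀ {n} (ν : Sign) (A : Fin n → Fin n → Carrier) (t : Carrier) →
    sumPerms (λ σ → sgnR σ * (prodAlong A σ * (signVal ν ^ length (inversions σ) * t)))
      ≈ detOrPer ν A * t
  signed-sum {n} plus A t = trans (sumR-cong {xs = perms n} (All.tabulate λ {σ} _ → begin
      sgnR σ * (prodAlong A σ * (1# ^ length (inversions σ) * t))
        ≈⟨ *-congˡ (*-congˡ (trans (*-congʳ (^-zeroˡ (length (inversions σ)))) (*-identityˡ t))) ⟩
      sgnR σ * (prodAlong A σ * t)
        ≈⟨ *-assoc _ _ _ ⟨
      sgnR σ * prodAlong A σ * t    ∎))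
    (sumR-*ʳ (λ σ → sgnR σ * prodAlong A σ) (perms n) t)
  signed-sum {n} minus A t = trans (sumR-cong {xs = perms n} (All.tabulate λ {σ} _ → begin
      sgnR σ * (prodAlong A σ * ((- 1#) ^ length (inversions σ) * t))
        ≈⟨ *-congˡ (x∙yz≈y∙xz _ _ t) ⟩
      sgnR σ * ((- 1#) ^ length (inversions σ) * (prodAlong A σ * t))
        ≈⟨ *-assoc _ _ _ ⟨
      sgnR σ * (- 1#) ^ length (inversions σ) * (prodAlong A σ * t)
        ≈⟨ trans (*-congʳ (foldr-negate*[-1]^length (inversions σ))) (*-identityˡ _) ⟩
      prodAlong A σ * t  ∎))
    (sumR-*ʳ (λ σ → prodAlong A σ) (perms n) t)
    where open CommSemigroupProperties *-commutativeSemigroup using (x∙yz≈y∙xz)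

module Diagonal {c ℓ : Level} (R : CommutativeRing c ℓ) {n : ℕ} (P : Poly.Pol R n) where

  open Poly R hiding (zero)
  open Functionals R
  open PermutationSums R
  open Exp semiring using (_^_)
  open import Relation.Binary.Reasoning.Setoid setoid

  shifts : (Fin n → ℕ) → Fin n → Pol 1
  shifts y k = X -P constP (natR (y k))

  fallingX : (Fin n → ℕ) → Pol 1
  fallingX y = prodP n (λ k → ffP X (y k))

  diagonalTerm : (Fin n → ℕ) → Pol 1
  diagonalTerm y = fallingX y *P subst (star P) (shifts y)

  diagonalTerm-cong : {y y′ : Fin n → ℕ} → (∀ k → y k ≡ y′ k) → diagonalTerm y ≃ diagonalTerm y′
  diagonalTerm-cong y≗y′ = *P-cong
    (prodP-cong n λ k → ≡⇒≃ (≡.cong (ffP X) (y≗y′ k)))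
    (subst-star-cong (≃-refl {p = P}) λ k → ≡⇒≃ (≡.cong (λ r → X -P constP (natR r)) (y≗y′ k)))

  fallingMonomial-⊕ : (E e : Vec ℕ n) →
    fallingMonomial (λ _ → X) (E ⊕ e) ≃ fallingX (lookup E) *P fallingMonomial (shifts (lookup E)) e
  fallingMonomial-⊕ E e = ≃-trans
    (prodP-cong n λ k → ≃-trans (≡⇒≃ (≡.cong (ffP X) (Vecₚ.lookup-zipWith ℕ._+_ k E e)))
                                (ffP-+ X (lookup E k) (lookup e k)))
    (prodP-*P n (λ k → ffP X (lookup E k)) (λ k → ffP (shifts (lookup E) k) (lookup e k)))

  ev-diagonal-*P : (D : Pol n) (h : Vec ℕ 1 → Carrier) →
    ev (subst (star (D *P P)) (λ _ → X)) h ≈ ev D (λ E → ev (diagonalTerm (lookup E)) h)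
  ev-diagonal-*P D h = begin
    ev (subst (star (D *P P)) (λ _ → X)) h                          ≈⟨ ev-subst-star _ (D *P P) h ⟩
    ev (D *P P) (λ e → ev (fallingMonomial (λ _ → X) e) h)           ≈⟨ ev-*P D P _ ⟩
    ev D (λ E → ev P (λ e → ev (fallingMonomial (λ _ → X) (E ⊕ e)) h)) ≈⟨ ev-cong D (λ E → monomial-term E) ⟩
    ev D (λ E → ev (diagonalTerm (lookup E)) h)                     ∎
    where
    monomial-term : ∀ E → ev P (λ e → ev (fallingMonomial (λ _ → X) (E ⊕ e)) h) ≈ ev (diagonalTerm (lookup E)) h
    monomial-term E = let y = lookup E ; W = fallingX y ; F = fallingMonomial (shifts y) in begin
      ev P (λ e → ev (fallingMonomial (λ _ → X) (E ⊕ e)) h)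
        ≈⟨ ev-cong P (λ e → ev≈ (fallingMonomial-⊕ E e) h) ⟩
      ev P (λ e → ev (W *P F e) h)
        ≈⟨ ev-cong P (λ e → ev-*P W (F e) h) ⟩
      ev P (λ e → ev W (λ u → ev (F e) (λ v → h (u ⊕ v))))
        ≈⟨ ev-comm W P _ ⟨
      ev W (λ u → ev P (λ e → ev (F e) (λ v → h (u ⊕ v))))
        ≈⟨ ev-cong W (λ u → ev-subst-star (shifts y) P _) ⟨
      ev W (λ u → ev (subst (star P) (shifts y)) (λ v → h (u ⊕ v)))
        ≈⟨ ev-*P W _ h ⟨
      ev (diagonalTerm y) h                                           ∎

  ev-diagonal-detP : (m : Fin n → ℕ) (A : Fin n → Fin n → Carrier) (h : Vec ℕ 1 → Carrier) →
    ev (subst (star (detP (matP m A) *P P)) (λ _ → X)) h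
      ≈ sumPerms (λ σ → sgnR σ * (prodAlong A σ * ev (diagonalTerm (pushforward σ m)) h))
  ev-diagonal-detP m A h = begin
    ev (subst (star (detP (matP m A) *P P)) (λ _ → X)) h
      ≈⟨ ev-diagonal-*P (detP (matP m A)) h ⟩
    ev (detP (matP m A)) φ
      ≈⟨ ev-sumP-map (λ σ → scaleP (sgnR σ) (prodP n (λ i → matP m A i (σ i)))) (perms n) φ ⟩
    sumPerms (λ σ → ev (scaleP (sgnR σ) (prodP n (λ i → matP m A i (σ i)))) φ)
      ≈⟨ sumR-cong {xs = perms n} (All.tabulate λ {σ} _ → term σ) ⟩
    sumPerms (λ σ → sgnR σ * (prodAlong A σ * ev (diagonalTerm (pushforward σ m)) h)) ∎
    where
    φ : Vec ℕ n → Carrier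
    φ E = ev (diagonalTerm (lookup E)) h
    term : ∀ σ → ev (scaleP (sgnR σ) (prodP n (λ i → matP m A i (σ i)))) φ
                   ≈ sgnR σ * (prodAlong A σ * ev (diagonalTerm (pushforward σ m)) h)
    term σ = trans (ev-scaleP (sgnR σ) (prodP n (λ i → matP m A i (σ i))) φ) (*-congˡ (trans
      (ev-prodP-singletons n (λ i → A i (σ i)) exponent φ)
      (*-congˡ (ev≈ (diagonalTerm-cong λ k →
        ≡.trans (lookup-vsum n exponent k) (sum-cong-≗ λ i → Vecₚ.lookup∘tabulate (x i) k)) h))))
      where
      x : Fin n → Fin n → ℕ
      x i k = if eqF k (σ i) then m i else 0
      exponent : Fin n → Vec ℕ n
      exponent i = tabulate (x i)

  ev-constP-*P-*P-fallingX : (d : Carrier) (m : Fin n → ℕ) (h : Vec ℕ 1 → Carrier) →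
    ev (constP d *P subst (star P) (shifts m) *P fallingX m) h ≈ d * ev (diagonalTerm m) h
  ev-constP-*P-*P-fallingX d m h = begin
    ev (constP d *P S *P fallingX m) h     ≈⟨ ev≈ (*P-assoc (constP d) S (fallingX m)) h ⟩
    ev (constP d *P (S *P fallingX m)) h   ≈⟨ ev-constP-*P d (S *P fallingX m) h ⟩
    d * ev (S *P fallingX m) h             ≈⟨ *-congˡ (ev≈ (*P-comm S (fallingX m)) h) ⟩
    d * ev (diagonalTerm m) h              ∎
    where
    S : Pol 1
    S = subst (star P) (shifts m)

  module Symmetric (ν : Sign) (symmetric : ∀ (i j : Fin n) → i < j → swapVars i j P ≈P scaleP (signVal ν) P) where

    open CommSemigroupProperties *-commutativeSemigroup using (x∙yz≈y∙xz)

    diagonalTerm-transpose : ∀ {a b} → a < b → ∀ y →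
                             diagonalTerm (y ∘ transpose a b) ≃ scaleP (signVal ν) (diagonalTerm y)
    diagonalTerm-transpose {a} {b} a<b y = ≃-trans
      (*P-cong (≃-sym (prodP-transpose n (λ k → ffP X (y k)) a b))
        (≃-trans (subst-star-transpose (shifts y) a b P)
          (≃-trans (subst-star-cong (≈P⇒≃ {p = swapVars a b P} {q = scaleP (signVal ν) P} (symmetric a b a<b))
                                    (λ _ → ≃-refl))
            (subst-star-scaleP (shifts y) (signVal ν) P))))
      (*P-scaleP (signVal ν) (fallingX y) (subst (star P) (shifts y)))

    diagonalTerm-pushforward : ∀ σ → T (isInjective σ) → ∀ m →
      diagonalTerm (pushforward σ m) ≃ scaleP (signVal ν ^ length (inversions σ)) (diagonalTerm m)
    diagonalTerm-pushforward σ injective =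
      ≡.subst (Invariance σ) (≡.sym (length-inversions σ))
        (bubble-induction Invariance base step σ (isInjective⇒injective σ injective))
      where
      Invariance : (Fin n → Fin n) → ℕ → Set _
      Invariance σ c = ∀ m → diagonalTerm (pushforward σ m) ≃ scaleP (signVal ν ^ c) (diagonalTerm m)
      base : ∀ σ → (∀ i → σ i ≡ i) → Invariance σ 0
      base σ σ≗id m = mk≃ λ h → trans (ev≈ (diagonalTerm-cong (pushforward-id σ σ≗id m)) h)
                                      (sym (trans (ev-scaleP 1# (diagonalTerm m) h) (*-identityˡ _)))
      step : ∀ σ a b c → Adjacent a b → Invariance (σ ∘ transpose a b) c → Invariance σ (suc c)
      step σ a b c adj invariance m = mk≃ λ h → let τ = transpose a b ; s = signVal ν in begin
        ev (diagonalTerm (pushforward σ m)) h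
          ≈⟨ ev≈ (diagonalTerm-cong (pushforward-transpose σ m a b)) h ⟩
        ev (diagonalTerm (pushforward (σ ∘ τ) (m ∘ τ))) h
          ≈⟨ ev≈ (invariance (m ∘ τ)) h ⟩
        ev (scaleP (s ^ c) (diagonalTerm (m ∘ τ))) h
          ≈⟨ ev-scaleP (s ^ c) (diagonalTerm (m ∘ τ)) h ⟩
        s ^ c * ev (diagonalTerm (m ∘ τ)) h
          ≈⟨ *-congˡ (ev≈ (diagonalTerm-transpose (adjacent⇒< adj) m) h) ⟩
        s ^ c * ev (scaleP s (diagonalTerm m)) h
          ≈⟨ *-congˡ (ev-scaleP s (diagonalTerm m) h) ⟩
        s ^ c * (s * ev (diagonalTerm m) h)
          ≈⟨ x∙yz≈y∙xz _ _ _ ⟩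
        s * (s ^ c * ev (diagonalTerm m) h)
          ≈⟨ *-assoc _ _ _ ⟨
        s ^ suc c * ev (diagonalTerm m) h
          ≈⟨ ev-scaleP (s ^ suc c) (diagonalTerm m) h ⟨
        ev (scaleP (s ^ suc c) (diagonalTerm m)) h          ∎

    sumPerms-diagonalTerm-pushforward : (m : Fin n → ℕ) (A : Fin n → Fin n → Carrier) (h : Vec ℕ 1 → Carrier) →
      sumPerms (λ σ → sgnR σ * (prodAlong A σ * ev (diagonalTerm (pushforward σ m)) h))
        ≈ sumPerms (λ σ → sgnR σ * (prodAlong A σ * (signVal ν ^ length (inversions σ) * ev (diagonalTerm m) h)))
    sumPerms-diagonalTerm-pushforward m A h =
      sumR-cong (All.map term (all-filter (λ σ → T? (isInjective σ)) (funs n n)))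
      where
      term : ∀ {σ} → T (isInjective σ) →
             sgnR σ * (prodAlong A σ * ev (diagonalTerm (pushforward σ m)) h)
               ≈ sgnR σ * (prodAlong A σ * (signVal ν ^ length (inversions σ) * ev (diagonalTerm m) h))
      term {σ} injective = *-congˡ (*-congˡ
        (trans (ev≈ (diagonalTerm-pushforward σ injective m) h) (ev-scaleP _ (diagonalTerm m) h)))

theorem2p1 : ∀ {c ℓ : Level} (R : CommutativeRing c ℓ) →
    let open Poly R in
    (n : ℕ) (m : Fin n → ℕ) (A : Fin n → Fin n → Carrier) (P : Pol n) (ν : Sign) →
    Homogeneous P →
    (∀ (i j : Fin n) → i < j → swapVars i j P ≈P scaleP (signVal ν) P) →
    subst (star (detP (matP m A) *P P)) (λ _ → X)
      ≈P (constP (detOrPer ν A)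
           *P (subst (star P) (λ k → X -P constP (natR (m k))))
           *P prodP n (λ i → ffP X (m i)))
theorem2p1 R n m A P ν _ symmetric = ≃⇒≈P {p = lhs} {q = rhs} (mk≃ λ h → begin
  ev lhs h
    ≈⟨ ev-diagonal-detP m A h ⟩
  sumPerms (λ σ → sgnR σ * (prodAlong A σ * ev (diagonalTerm (pushforward σ m)) h))
    ≈⟨ sumPerms-diagonalTerm-pushforward m A h ⟩
  sumPerms (λ σ → sgnR σ * (prodAlong A σ * (signVal ν ^ length (inversions σ) * ev (diagonalTerm m) h)))
    ≈⟨ signed-sum ν A (ev (diagonalTerm m) h) ⟩
  detOrPer ν A * ev (diagonalTerm m) h
    ≈⟨ ev-constP-*P-*P-fallingX (detOrPer ν A) m h ⟨
  ev rhs h ∎)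
  where
  open Poly R hiding (zero)
  open Functionals R
  open PermutationSums R
  open Diagonal R P
  open Symmetric ν symmetric
  open Exp semiring using (_^_)
  open import Relation.Binary.Reasoning.Setoid setoid
  lhs rhs : Pol 1
  lhs = subst (star (detP (matP m A) *P P)) (λ _ → X)
  rhs = constP (detOrPer ν A) *P subst (star P) (shifts m) *P fallingX m
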